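{- $(\mathbf{P},+,\times)$ is a commutative semiring, with additive identity $(0)$ (the null sequence) and multiplicative identity $(1)$ (the sequence $(1,0,0,\ldots)$).
   Context: A profile is a sequence $\mathbf{p}=(p_i)_{i\in\mathbb{N}}$ of natural numbers for which there exists $h\ge -1$ with $p_i\ge 1$ for $0\le i\le h$ and $p_i=0$ for $i>h$ (so the null sequence $(0)$ is a profile). Equivalently, the profiles are exactly the sequences $(|A|_i)_{i\in\mathbb{N}}$ where $(A,f)$ is a finite dynamical system ($A$ a finite, possibly empty, set and $f\colon A\to A$) and $|A|_i$ is the number of states $x\in A$ of height $i$, the height of $x$ being the least $h\ge 0$ such that $f^h(x)$ is periodic. $\mathbf{P}$ denotes the set of profiles. Sum: $\mathbf{p}+\mathbf{q}=(p_i+q_i)_{i\in\mathbb{N}}$. Product: $(\mathbf{p}\times\mathbf{q})_i = p_i\sum_{j=0}^i q_j + q_i\sum_{j=0}^i p_j - p_i q_i$ for all $i\in\mathbb{N}$. A profile is written as the finite sequence of its nonzero terms, e.g. $(2,1)=(2,1,0,0,\ldots)$. -}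

module Defs where

open import Data.Nat using (ℕ; zero; suc; _+_; _*_; _∸_; _≤_; _<_)
open import Data.Product using (Σ; ∃; _×_; _,_; proj₁; proj₂)
open import Relation.Binary.PropositionalEquality using (_≡_)

Seq : Set
Seq = ℕ → ℕ

-- p is a profile: there is h ≥ -1 with p i ≥ 1 for 0 ≤ i ≤ h and p i = 0 for i > h.
-- We use n = h + 1 ∈ ℕ (so n = 0 corresponds to h = -1, the null sequence).
IsProfile : Seq → Set
IsProfile p = ∃ λ n → (∀ i → i < n → 1 ≤ p i) × (∀ i → n ≤ i → p i ≡ 0)

Profile : Set
Profile = Σ Seq IsProfile

_≈ᴾ_ : Profile → Profile → Set
p ≈ᴾ q = ∀ i → proj₁ p i ≡ proj₁ q i

S : Seq → ℕ → ℕ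
S p zero    = p zero
S p (suc i) = S p i + p (suc i)

_⊕_ : Seq → Seq → Seq
(p ⊕ q) i = p i + q i

-- product of sequences:
-- (p × q)_i = p_i Σ_{j≤i} q_j + q_i Σ_{j≤i} p_j − p_i q_i
-- (the subtraction never truncates since p_i q_i ≤ p_i Σ_{j≤i} q_j)
_⊗_ : Seq → Seq → Seq
(p ⊗ q) i = (p i * S q i + q i * S p i) ∸ p i * q i

zeroSeq : Seq
zeroSeq _ = 0

oneSeq : Seq
oneSeq zero    = 1
oneSeq (suc _) = 0

record Closed : Set where
  field
    ⊕-closed : ∀ {p q} → IsProfile p → IsProfile q → IsProfile (p ⊕ q)
    ⊗-closed : ∀ {p q} → IsProfile p → IsProfile q → IsProfile (p ⊗ q)
    zero-prof : IsProfile zeroSeq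
    one-prof  : IsProfile oneSeq

module Ops (c : Closed) where
  open Closed c

  _+ᴾ_ : Profile → Profile → Profile
  (p , hp) +ᴾ (q , hq) = p ⊕ q , ⊕-closed hp hq

  _×ᴾ_ : Profile → Profile → Profile
  (p , hp) ×ᴾ (q , hq) = p ⊗ q , ⊗-closed hp hq

  0ᴾ : Profile
  0ᴾ = zeroSeq , zero-prof

  1ᴾ : Profile
  1ᴾ = oneSeq , one-prof

-- The prefix-sum map p ↦ S p turns × into the pointwise product: the i-th term
-- of p × q is exactly the increment S p i · S q i − S p (i−1) · S q (i−1).
-- Since it also turns + into pointwise sum and is injective, P embeds as a
-- subsemiring of the pointwise semiring ℕ^ℕ, and all the laws are inherited.
module Submission where

open import Defs
open import Algebra.Bundles using (RawSemiring; CommutativeSemiring)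
open import Algebra.Definitions using (_DistributesOverʳ_; LeftZero)
open import Algebra.Structures using (IsMagma; IsCommutativeSemiring)
open import Algebra.Structures.Biased using (IsCommutativeSemiringˡ)
open import Algebra.Morphism.Structures using (IsSemiringMonomorphism)
import Algebra.Morphism.MonoidMonomorphism as MonoidMonomorphism
import Algebra.Construct.Pointwise as Pointwise
open import Data.Nat using (ℕ; zero; suc; _+_; _*_; _∸_; _≤_; _<_; _⊔_; z≤n; s≤s)
open import Data.Nat.Properties
open import Data.Nat.Tactic.RingSolver using (solve-∀)
open import Data.Product using (Σ; _,_; proj₁; _×_)
open import Data.Sum using (inj₁; inj₂)
open import Relation.Binary.PropositionalEquality
  using (_≡_; refl; trans; cong; cong₂; subst; module ≡-Reasoning)
import Relation.Binary.Reasoning.Setoid as ≈-Reasoning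
open import Level using (0ℓ)

module CommutativeSemiringMonomorphism
  {a b ℓ₁ ℓ₂} {R₁ : RawSemiring a ℓ₁} {R₂ : RawSemiring b ℓ₂} {⟦_⟧}
  (isSemiringMonomorphism : IsSemiringMonomorphism R₁ R₂ ⟦_⟧)
  where

  open IsSemiringMonomorphism isSemiringMonomorphism
  open RawSemiring R₁ using () renaming
    (_≈_ to _≈₁_; _+_ to _+₁_; _*_ to _*₁_; 0# to 0#₁; 1# to 1#₁)
  open RawSemiring R₂ using () renaming
    (_≈_ to _≈₂_; _+_ to _+₂_; _*_ to _*₂_; 0# to 0#₂; 1# to 1#₂)
  module + = MonoidMonomorphism +-isMonoidMonomorphism
  module * = MonoidMonomorphism *-isMonoidMonomorphism

  module _ (+-isMagma : IsMagma _≈₂_ _+₂_) (*-isMagma : IsMagma _≈₂_ _*₂_) where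

    open IsMagma +-isMagma using (∙-cong) renaming (refl to ≈-refl)
    open IsMagma *-isMagma using () renaming (∙-cong to *-cong)
    open ≈-Reasoning (IsMagma.setoid +-isMagma)

    distribʳ : _DistributesOverʳ_ _≈₂_ _*₂_ _+₂_ → _DistributesOverʳ_ _≈₁_ _*₁_ _+₁_
    distribʳ distribʳ₂ x y z = injective (begin
      ⟦ (y +₁ z) *₁ x ⟧                 ≈⟨ *-homo (y +₁ z) x ⟩
      ⟦ y +₁ z ⟧ *₂ ⟦ x ⟧               ≈⟨ *-cong (+-homo y z) ≈-refl ⟩
      (⟦ y ⟧ +₂ ⟦ z ⟧) *₂ ⟦ x ⟧         ≈⟨ distribʳ₂ ⟦ x ⟧ ⟦ y ⟧ ⟦ z ⟧ ⟩
      ⟦ y ⟧ *₂ ⟦ x ⟧ +₂ ⟦ z ⟧ *₂ ⟦ x ⟧ ≈⟨ ∙-cong (*-homo y x) (*-homo z x) ⟨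
      ⟦ y *₁ x ⟧ +₂ ⟦ z *₁ x ⟧          ≈⟨ +-homo (y *₁ x) (z *₁ x) ⟨
      ⟦ y *₁ x +₁ z *₁ x ⟧              ∎)

    zeroˡ : LeftZero _≈₂_ 0#₂ _*₂_ → LeftZero _≈₁_ 0#₁ _*₁_
    zeroˡ zeroˡ₂ x = injective (begin
      ⟦ 0#₁ *₁ x ⟧     ≈⟨ *-homo 0#₁ x ⟩
      ⟦ 0#₁ ⟧ *₂ ⟦ x ⟧ ≈⟨ *-cong 0#-homo ≈-refl ⟩
      0#₂ *₂ ⟦ x ⟧     ≈⟨ zeroˡ₂ ⟦ x ⟧ ⟩
      0#₂              ≈⟨ 0#-homo ⟨
      ⟦ 0#₁ ⟧          ∎)

  isCommutativeSemiring : IsCommutativeSemiring _≈₂_ _+₂_ _*₂_ 0#₂ 1#₂ →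
                          IsCommutativeSemiring _≈₁_ _+₁_ _*₁_ 0#₁ 1#₁
  isCommutativeSemiring isCommSemiring = IsCommutativeSemiringˡ.isCommutativeSemiring record
    { +-isCommutativeMonoid = +.isCommutativeMonoid C.+-isCommutativeMonoid
    ; *-isCommutativeMonoid = *.isCommutativeMonoid C.*-isCommutativeMonoid
    ; distribʳ = distribʳ C.+-isMagma C.*-isMagma C.distribʳ
    ; zeroˡ    = zeroˡ C.+-isMagma C.*-isMagma C.zeroˡ
    }
    where module C = IsCommutativeSemiring isCommSemiring

S-cong : ∀ {p q} → (∀ i → p i ≡ q i) → ∀ i → S p i ≡ S q i
S-cong p≗q zero    = p≗q 0
S-cong p≗q (suc i) = cong₂ _+_ (S-cong p≗q i) (p≗q (suc i))

S-injective : ∀ {p q} → (∀ i → S p i ≡ S q i) → ∀ i → p i ≡ q i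
S-injective Sp≗Sq zero = Sp≗Sq 0
S-injective {p} {q} Sp≗Sq (suc i) = +-cancelˡ-≡ (S p i) (p (suc i)) (q (suc i)) (begin
  S p i + p (suc i) ≡⟨ Sp≗Sq (suc i) ⟩
  S q i + q (suc i) ≡⟨ cong (_+ q (suc i)) (Sp≗Sq i) ⟨
  S p i + q (suc i) ∎)
  where open ≡-Reasoning

S-zeroSeq : ∀ i → S zeroSeq i ≡ 0
S-zeroSeq zero    = refl
S-zeroSeq (suc i) = cong (_+ 0) (S-zeroSeq i)

S-oneSeq : ∀ i → S oneSeq i ≡ 1
S-oneSeq zero    = refl
S-oneSeq (suc i) = cong (_+ 0) (S-oneSeq i)

S-⊕ : ∀ p q i → S (p ⊕ q) i ≡ S p i + S q i
S-⊕ p q zero    = refl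
S-⊕ p q (suc i) = begin
  S (p ⊕ q) i + (p (suc i) + q (suc i))       ≡⟨ cong (_+ (p (suc i) + q (suc i))) (S-⊕ p q i) ⟩
  S p i + S q i + (p (suc i) + q (suc i))     ≡⟨ +-+-interchange (S p i) _ _ _ ⟩
  S p i + p (suc i) + (S q i + q (suc i))     ∎
  where
  open ≡-Reasoning
  +-+-interchange : ∀ w x y z → w + x + (y + z) ≡ w + y + (x + z)
  +-+-interchange = solve-∀

-- The subtracted x·y never truncates: it is one of the two copies of x·y on the left.
⊗-term : ∀ x y X Y → (x * (Y + y) + y * (X + x)) ∸ x * y ≡ x * Y + y * X + x * y
⊗-term x y X Y = begin
  (x * (Y + y) + y * (X + x)) ∸ x * y ≡⟨ cong (_∸ x * y) (expand x y X Y) ⟩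
  (x * Y + y * X + x * y) + x * y ∸ x * y ≡⟨ m+n∸n≡m _ (x * y) ⟩
  x * Y + y * X + x * y ∎
  where
  open ≡-Reasoning
  expand : ∀ x y X Y → x * (Y + y) + y * (X + x) ≡ (x * Y + y * X + x * y) + x * y
  expand = solve-∀

S-⊗ : ∀ p q i → S (p ⊗ q) i ≡ S p i * S q i
-- S p 0 = p 0 is definitionally 0 + p 0, so ⊗-term applies with X = Y = 0.
S-⊗ p q zero = trans (⊗-term (p 0) (q 0) 0 0) (simplify (p 0) (q 0))
  where
  simplify : ∀ x y → x * 0 + y * 0 + x * y ≡ x * y
  simplify = solve-∀
S-⊗ p q (suc i) = begin
  S (p ⊗ q) i + (p ⊗ q) (suc i)           ≡⟨ cong₂ _+_ (S-⊗ p q i) (⊗-term x y X Y) ⟩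
  X * Y + (x * Y + y * X + x * y)         ≡⟨ expand X Y x y ⟩
  (X + x) * (Y + y)                       ∎
  where
  open ≡-Reasoning
  X = S p i
  Y = S q i
  x = p (suc i)
  y = q (suc i)
  expand : ∀ X Y x y → X * Y + (x * Y + y * X + x * y) ≡ (X + x) * (Y + y)
  expand = solve-∀

⊗-comm : ∀ p q i → (p ⊗ q) i ≡ (q ⊗ p) i
⊗-comm p q i = cong₂ _∸_ (+-comm (p i * S q i) (q i * S p i)) (*-comm (p i) (q i))

p₀≤S : ∀ p i → p 0 ≤ S p i
p₀≤S p zero    = ≤-refl
p₀≤S p (suc i) = ≤-trans (p₀≤S p i) (m≤m+n (S p i) (p (suc i)))

p≤S : ∀ p i → p i ≤ S p i
p≤S p zero    = ≤-refl
p≤S p (suc i) = m≤n+m (p (suc i)) (S p i)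

pS≤⊗ : ∀ p q i → p i * S q i ≤ (p ⊗ q) i
pS≤⊗ p q i = begin
  p i * S q i                                   ≤⟨ m≤m+n _ _ ⟩
  p i * S q i + (q i * S p i ∸ p i * q i)       ≡⟨ +-∸-assoc (p i * S q i) qp≤qS ⟨
  (p ⊗ q) i                                     ∎
  where
  open ≤-Reasoning
  qp≤qS : p i * q i ≤ q i * S p i
  qp≤qS = subst (_≤ q i * S p i) (*-comm (q i) (p i)) (*-monoʳ-≤ (q i) (p≤S p i))

⊗-positive : ∀ p q i → 1 ≤ p i → 1 ≤ q 0 → 1 ≤ (p ⊗ q) i
⊗-positive p q i 1≤pᵢ 1≤q₀ = ≤-trans (*-mono-≤ 1≤pᵢ (≤-trans 1≤q₀ (p₀≤S q i))) (pS≤⊗ p q i)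

⊗-zeroˡ : ∀ p q → (∀ i → p i ≡ 0) → ∀ i → (p ⊗ q) i ≡ 0
⊗-zeroˡ p q p≗0 i rewrite p≗0 i | trans (S-cong p≗0 i) (S-zeroSeq i) = *-zeroʳ (q i)

⊗-vanishes : ∀ p q i → p i ≡ 0 → q i ≡ 0 → (p ⊗ q) i ≡ 0
⊗-vanishes p q i pᵢ≡0 qᵢ≡0 rewrite pᵢ≡0 | qᵢ≡0 = refl

IsProfileOfLength : Seq → ℕ → Set
IsProfileOfLength p n = (∀ i → i < n → 1 ≤ p i) × (∀ i → n ≤ i → p i ≡ 0)

length-⊔ : ∀ {p q r n m} →
           (∀ i → 1 ≤ p i → 1 ≤ r i) → (∀ i → 1 ≤ q i → 1 ≤ r i) →
           (∀ i → p i ≡ 0 → q i ≡ 0 → r i ≡ 0) →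
           IsProfileOfLength p n → IsProfileOfLength q m → IsProfileOfLength r (n ⊔ m)
length-⊔ {r = r} {n} {m} p⇒r q⇒r vanish (p-pos , p-zero) (q-pos , q-zero) = r-pos , r-zero
  where
  r-pos : ∀ i → i < n ⊔ m → 1 ≤ r i
  r-pos i i<n⊔m with ≤-total n m
  ... | inj₁ n≤m = q⇒r i (q-pos i (subst (i <_) (m≤n⇒m⊔n≡n n≤m) i<n⊔m))
  ... | inj₂ m≤n = p⇒r i (p-pos i (subst (i <_) (m≥n⇒m⊔n≡m m≤n) i<n⊔m))
  r-zero : ∀ i → n ⊔ m ≤ i → r i ≡ 0
  r-zero i n⊔m≤i = vanish i (p-zero i (≤-trans (m≤m⊔n n m) n⊔m≤i))
                            (q-zero i (≤-trans (m≤n⊔m n m) n⊔m≤i))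

⊕-closed : ∀ {p q} → IsProfile p → IsProfile q → IsProfile (p ⊕ q)
⊕-closed {p} {q} (n , p-len) (m , q-len) = n ⊔ m , length-⊔
  (λ i 1≤pᵢ → ≤-trans 1≤pᵢ (m≤m+n (p i) (q i)))
  (λ i 1≤qᵢ → ≤-trans 1≤qᵢ (m≤n+m (q i) (p i)))
  (λ i pᵢ≡0 qᵢ≡0 → cong₂ _+_ pᵢ≡0 qᵢ≡0)
  p-len q-len

⊗-closed : ∀ {p q} → IsProfile p → IsProfile q → IsProfile (p ⊗ q)
⊗-closed {p} {q} (zero , _ , p≗0) _ =
  0 , (λ _ ()) , λ i _ → ⊗-zeroˡ p q (λ j → p≗0 j z≤n) i
⊗-closed {p} {q} (suc n , _) (zero , _ , q≗0) =
  0 , (λ _ ()) , λ i _ → trans (⊗-comm p q i) (⊗-zeroˡ q p (λ j → q≗0 j z≤n) i)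
⊗-closed {p} {q} (suc n , p-len@(p-pos , _)) (suc m , q-len@(q-pos , _)) = suc n ⊔ suc m , length-⊔
  (λ i 1≤pᵢ → ⊗-positive p q i 1≤pᵢ (q-pos 0 (s≤s z≤n)))
  (λ i 1≤qᵢ → subst (1 ≤_) (⊗-comm q p i) (⊗-positive q p i 1≤qᵢ (p-pos 0 (s≤s z≤n))))
  (⊗-vanishes p q)
  p-len q-len

closed : Closed
closed = record
  { ⊕-closed  = ⊕-closed
  ; ⊗-closed  = ⊗-closed
  ; zero-prof = 0 , (λ _ ()) , (λ _ _ → refl)
  ; one-prof  = 1 , (λ { zero _ → ≤-refl ; (suc _) (s≤s ()) }) , (λ { zero () ; (suc _) _ → refl })
  }

open Ops closed

profileSemiring : RawSemiring 0ℓ 0ℓ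
profileSemiring = record
  { _≈_ = _≈ᴾ_ ; _+_ = _+ᴾ_ ; _*_ = _×ᴾ_ ; 0# = 0ᴾ ; 1# = 1ᴾ }

S-isSemiringMonomorphism : IsSemiringMonomorphism profileSemiring
  (CommutativeSemiring.rawSemiring (Pointwise.commutativeSemiring ℕ +-*-commutativeSemiring))
  (λ p → S (proj₁ p))
S-isSemiringMonomorphism = record
  { isSemiringHomomorphism = record
    { isNearSemiringHomomorphism = record
      { +-isMonoidHomomorphism = record
        { isMagmaHomomorphism = record
          { isRelHomomorphism = record { cong = S-cong }
          ; homo = λ p q → S-⊕ (proj₁ p) (proj₁ q)
          }
        ; ε-homo = S-zeroSeq
        }
      ; *-homo = λ p q → S-⊗ (proj₁ p) (proj₁ q)
      }
    ; 1#-homo = S-oneSeq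
    }
  ; injective = S-injective
  }

theorem1 : Σ Closed (λ c → IsCommutativeSemiring _≈ᴾ_ (Ops._+ᴾ_ c) (Ops._×ᴾ_ c) (Ops.0ᴾ c) (Ops.1ᴾ c))
theorem1 = closed , CommutativeSemiringMonomorphism.isCommutativeSemiring S-isSemiringMonomorphism
  (Pointwise.isCommutativeSemiring ℕ +-*-isCommutativeSemiring)
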